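{- The class of all finite graphs can be (semantically) interpreted in $Q_{\mathrm{fin}}(\overline{\mathbf{B}}_1)$, the class of finite members of the quasivariety generated by $\overline{\mathbf{B}}_1$. More precisely, there are first-order formulas in the language of p-algebras such that for every finite graph $G$ there is a finite algebra in $Q(\overline{\mathbf{B}}_1)$ in which these formulas define a graph isomorphic to $G$.
   Context: A p-algebra is an algebra $(A;\wedge,\vee,{}^*,0,1)$ where $(A;\wedge,\vee,0,1)$ is a bounded distributive lattice and ${}^*$ is a unary operation satisfying $x\wedge y=0 \iff y\le x^*$. $\overline{\mathbf{B}}_1$ is the three-element p-algebra on the chain $0<e<1$ (with $0^*=1$, $e^*=1^*=0$). For a class $\mathcal{K}$, $Q(\mathcal{K})$ is the quasivariety it generates and $Q_{\mathrm{fin}}(\mathcal{K})$ the class of finite members of $Q(\mathcal{K})$. Graphs are simple undirected graphs $(V,E)$ with $E$ a set of two-element subsets of $V$. -}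

module Defs where

open import Data.Nat using (ℕ; zero; suc; _+_)
open import Data.Fin using (Fin; zero; suc)
open import Data.Bool using (Bool; true; false)
open import Data.Product using (Σ; _×_; _,_; ∃)
open import Data.Sum using (_⊎_)
open import Data.Empty using (⊥)
open import Data.List using (List)
open import Data.List.Relation.Unary.All using (All)
open import Relation.Binary.PropositionalEquality using (_≡_)
open import Relation.Nullary using (¬_)
open import Data.Vec.Functional using (Vector; _++_)

data Term (n : ℕ) : Set where
  var  : Fin n → Term n
  _∧ₜ_ : Term n → Term n → Term n
  _∨ₜ_ : Term n → Term n → Term n
  _*ₜ  : Term n → Term n
  0ₜ   : Term n
  1ₜ   : Term n

data Formula : ℕ → Set where
  _≐_  : ∀ {n} → Term n → Term n → Formula n
  ⊥f   : ∀ {n} → Formula n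
  ¬f_  : ∀ {n} → Formula n → Formula n
  _∧f_ : ∀ {n} → Formula n → Formula n → Formula n
  _∨f_ : ∀ {n} → Formula n → Formula n → Formula n
  _⇒f_ : ∀ {n} → Formula n → Formula n → Formula n
  ∃f   : ∀ {n} → Formula (suc n) → Formula n
  ∀f   : ∀ {n} → Formula (suc n) → Formula n

record FinAlg : Set where
  field
    size : ℕ
    meet : Fin size → Fin size → Fin size
    join : Fin size → Fin size → Fin size
    star : Fin size → Fin size
    bot  : Fin size
    top  : Fin size

open FinAlg public

⟦_⟧ₜ : ∀ {n} (A : FinAlg) → Term n → (Fin n → Fin (size A)) → Fin (size A)
⟦ A ⟧ₜ (var i)  ρ = ρ i
⟦ A ⟧ₜ (s ∧ₜ t) ρ = meet A (⟦ A ⟧ₜ s ρ) (⟦ A ⟧ₜ t ρ)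
⟦ A ⟧ₜ (s ∨ₜ t) ρ = join A (⟦ A ⟧ₜ s ρ) (⟦ A ⟧ₜ t ρ)
⟦ A ⟧ₜ (s *ₜ)   ρ = star A (⟦ A ⟧ₜ s ρ)
⟦ A ⟧ₜ 0ₜ       ρ = bot A
⟦ A ⟧ₜ 1ₜ       ρ = top A

extend : ∀ {a} {X : Set a} {n} → X → (Fin n → X) → Fin (suc n) → X
extend x ρ zero    = x
extend x ρ (suc i) = ρ i

Sat : ∀ {n} (A : FinAlg) → Formula n → (Fin n → Fin (size A)) → Set
Sat A (s ≐ t)  ρ = ⟦ A ⟧ₜ s ρ ≡ ⟦ A ⟧ₜ t ρ
Sat A ⊥f       ρ = ⊥
Sat A (¬f φ)   ρ = ¬ Sat A φ ρ
Sat A (φ ∧f ψ) ρ = Sat A φ ρ × Sat A ψ ρ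
Sat A (φ ∨f ψ) ρ = Sat A φ ρ ⊎ Sat A ψ ρ
Sat A (φ ⇒f ψ) ρ = Sat A φ ρ → Sat A ψ ρ
Sat A (∃f φ)   ρ = Σ (Fin (size A)) λ a → Sat A φ (extend a ρ)
Sat A (∀f φ)   ρ = (a : Fin (size A)) → Sat A φ (extend a ρ)

record QuasiIdentity : Set where
  field
    nvars : ℕ
    hyps  : List (Term nvars × Term nvars)
    concl : Term nvars × Term nvars

HoldsEq : ∀ {n} (A : FinAlg) → (Fin n → Fin (size A)) → Term n × Term n → Set
HoldsEq A ρ (s , t) = ⟦ A ⟧ₜ s ρ ≡ ⟦ A ⟧ₜ t ρ

_⊨q_ : FinAlg → QuasiIdentity → Set
A ⊨q q = (ρ : Fin (QuasiIdentity.nvars q) → Fin (size A))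
       → All (HoldsEq A ρ) (QuasiIdentity.hyps q)
       → HoldsEq A ρ (QuasiIdentity.concl q)

-- A ∈ Q(B): A satisfies every quasi-identity that holds in B
-- (the quasivariety generated by B is the class of models of the
--  quasi-identities valid in B)
InQ : FinAlg → FinAlg → Set
InQ B A = (q : QuasiIdentity) → B ⊨q q → A ⊨q q

-- The three-element p-algebra B̄₁ on the chain 0 < e < 1
-- (encoded as 0 ↦ zero, e ↦ suc zero, 1 ↦ suc (suc zero))

private
  min3 : Fin 3 → Fin 3 → Fin 3
  min3 zero    y             = zero
  min3 (suc x) zero          = zero
  min3 (suc zero) (suc y)    = suc zero
  min3 (suc (suc x)) (suc y) = suc y

  max3 : Fin 3 → Fin 3 → Fin 3
  max3 zero    y             = y
  max3 (suc x) zero          = suc x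
  max3 (suc zero) (suc y)    = suc y
  max3 (suc (suc x)) (suc y) = suc (suc x)

  star3 : Fin 3 → Fin 3
  star3 zero    = suc (suc zero)
  star3 (suc x) = zero

B̄₁ : FinAlg
B̄₁ = record
  { size = 3 ; meet = min3 ; join = max3 ; star = star3
  ; bot = zero ; top = suc (suc zero) }

record Graph : Set where
  field
    V       : ℕ
    adj     : Fin V → Fin V → Bool
    adj-sym : ∀ u v → adj u v ≡ adj v u
    irrefl  : ∀ v → adj v v ≡ false

-- "The formulas (dom, eqv, edge) of dimension k define in A a graph
-- isomorphic to G": there is a surjection f from the k-tuples of A
-- satisfying dom onto the vertices of G whose kernel is exactly eqv
-- and which carries edge exactly onto adjacency of G.  (Equivalently,
-- eqv is an equivalence relation on dom(A) and the quotient graph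
-- (dom(A)/eqv, edge) is isomorphic to G.)

Defines : (A : FinAlg) (k : ℕ) → Formula k → Formula (k + k) → Formula (k + k)
        → Graph → Set
Defines A k dom eqv edge G =
  Σ ((x : Vector (Fin (size A)) k) → Sat A dom x → Fin (Graph.V G)) λ f →
      ((v : Fin (Graph.V G)) → Σ (Vector (Fin (size A)) k) λ x →
                                Σ (Sat A dom x) λ p → f x p ≡ v)
    × ((x y : Vector (Fin (size A)) k) (p : Sat A dom x) (q : Sat A dom y) →
         (f x p ≡ f y q → Sat A eqv (x ++ y))
       × (Sat A eqv (x ++ y) → f x p ≡ f y q))
    × ((x y : Vector (Fin (size A)) k) (p : Sat A dom x) (q : Sat A dom y) →
         (Graph.adj G (f x p) (f y q) ≡ true → Sat A edge (x ++ y))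
       × (Sat A edge (x ++ y) → Graph.adj G (f x p) (f y q) ≡ true))

{-# OPTIONS --safe #-}
module Submission where

-- Let D be the distributive lattice of subgraphs of G (a set of vertices together with a
-- set of arcs between them) and let A be D with a new bottom 0 adjoined; A is a p-algebra
-- with x* = 0 for every x ≠ 0.  Reading off a subgraph at a vertex, at an arc, or just
-- asking whether it is nonzero gives homomorphisms A → B̄₁ that jointly separate points,
-- so A lies in Q(B̄₁).  In A the elements of height two are exactly the one-vertex
-- subgraphs ⟨v⟩, and ⟨u⟩ ∨ ⟨v⟩ is the unique lower cover of some element exactly when u
-- and v are adjacent (the witness adds the arc u → v).  Both properties are first-order.

open import Defs
open import Data.Bool using (Bool; true; false; T; _∧_; _∨_)
open import Data.Bool.Properties using (T-∧; T-∨; T-≡) renaming (_≟_ to _≟ᵇ_)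
open import Data.Fin using (Fin; zero; suc)
open import Data.Fin.Properties using (_≟_; any?)
open import Data.List using (List; []; _∷_; length; lookup; deduplicate; map; cartesianProduct; cartesianProductWith)
open import Data.List.Membership.Propositional using (_∈_)
open import Data.List.Membership.Propositional.Properties
  using (∈-lookup; ∈-deduplicate⁺; ∈-deduplicate⁻; ∈-map⁺; ∈-map⁻;
         ∈-cartesianProductWith⁺; ∈-cartesianProduct⁺)
open import Data.List.Relation.Unary.All as All using (All)
open import Data.List.Relation.Unary.AllPairs using (_∷_)
open import Data.List.Relation.Unary.Any using (index; here; there)
open import Data.List.Relation.Unary.Any.Properties using (lookup-index)
open import Data.List.Relation.Unary.Unique.DecPropositional.Properties using (deduplicate-!)
open import Data.List.Relation.Unary.Unique.Propositional using (Unique)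
open import Data.Maybe using (Maybe; nothing; just)
import Data.Maybe.Properties as Maybeₚ
open import Data.Nat using (ℕ; zero; suc; _+_)
open import Data.Product using (Σ; _×_; _,_; proj₁; proj₂)
import Data.Product as Product
import Data.Product.Properties as Productₚ
open import Data.Sum using (_⊎_; inj₁; inj₂; [_,_])
import Data.Sum as Sum
open import Data.Unit using (tt)
open import Data.Vec using (Vec; []; _∷_)
import Data.Vec as Vec
open import Data.Vec.Functional using (Vector; _++_)
open import Data.Vec.Properties using (lookup∘tabulate; tabulate-cong)
import Data.Vec.Properties as Vecₚ
open import Function using (_∘_)
open import Function.Bundles using (Equivalence)
open import Relation.Binary.Definitions using (DecidableEquality)
open import Relation.Binary.PropositionalEquality hiding ([_])
open import Relation.Nullary using (¬_; contradiction; yes; no)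
open import Relation.Nullary.Decidable using (⌊_⌋; T?; toWitness; fromWitness)

open Equivalence using (to; from)

T-ext : ∀ {x y} → (T x → T y) → (T y → T x) → x ≡ y
T-ext {false} {false} _ _ = refl
T-ext {false} {true}  _ g = contradiction tt g
T-ext {true}  {false} f _ = contradiction tt f
T-ext {true}  {true}  _ _ = refl

∧-implied : ∀ {x y} → (T x → T y) → x ∧ y ≡ x
∧-implied {false}         _ = refl
∧-implied {true}  {true}  _ = refl
∧-implied {true}  {false} f = contradiction tt f

record RawPAlgebra : Set₁ where
  infixl 7 _⊓_
  infixl 6 _⊔_
  field
    Carrier : Set
    _⊓_ _⊔_ : Carrier → Carrier → Carrier
    _*      : Carrier → Carrier
    0# 1#   : Carrier

asRaw : FinAlg → RawPAlgebra
asRaw A = record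
  { Carrier = Fin (size A) ; _⊓_ = meet A ; _⊔_ = join A ; _* = star A
  ; 0# = bot A ; 1# = top A }

module _ (A B : RawPAlgebra) where
  private
    module A = RawPAlgebra A
    module B = RawPAlgebra B

  record IsHomomorphism (h : A.Carrier → B.Carrier) : Set where
    field
      ⊓-homo : ∀ x y → h (x A.⊓ y) ≡ h x B.⊓ h y
      ⊔-homo : ∀ x y → h (x A.⊔ y) ≡ h x B.⊔ h y
      *-homo : ∀ x → h (x A.*) ≡ h x B.*
      0-homo : h A.0# ≡ B.0#
      1-homo : h A.1# ≡ B.1#

∘-isHomomorphism : ∀ {A B C : RawPAlgebra} {g f} →
                   IsHomomorphism B C g → IsHomomorphism A B f → IsHomomorphism A C (g ∘ f)
∘-isHomomorphism {g = g} {f} g-hom f-hom = record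
  { ⊓-homo = λ x y → trans (cong g (F.⊓-homo x y)) (G.⊓-homo (f x) (f y))
  ; ⊔-homo = λ x y → trans (cong g (F.⊔-homo x y)) (G.⊔-homo (f x) (f y))
  ; *-homo = λ x → trans (cong g (F.*-homo x)) (G.*-homo (f x))
  ; 0-homo = trans (cong g F.0-homo) G.0-homo
  ; 1-homo = trans (cong g F.1-homo) G.1-homo
  }
  where
  module F = IsHomomorphism f-hom
  module G = IsHomomorphism g-hom

module _ {A B : FinAlg} {h : Fin (size A) → Fin (size B)}
         (h-hom : IsHomomorphism (asRaw A) (asRaw B) h) where
  open IsHomomorphism h-hom

  ⟦⟧-homo : ∀ {n} (t : Term n) (ρ : Fin n → Fin (size A)) → h (⟦ A ⟧ₜ t ρ) ≡ ⟦ B ⟧ₜ t (h ∘ ρ)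
  ⟦⟧-homo (var i)  ρ = refl
  ⟦⟧-homo (s ∧ₜ t) ρ = trans (⊓-homo _ _) (cong₂ (meet B) (⟦⟧-homo s ρ) (⟦⟧-homo t ρ))
  ⟦⟧-homo (s ∨ₜ t) ρ = trans (⊔-homo _ _) (cong₂ (join B) (⟦⟧-homo s ρ) (⟦⟧-homo t ρ))
  ⟦⟧-homo (t *ₜ)   ρ = trans (*-homo _) (cong (star B) (⟦⟧-homo t ρ))
  ⟦⟧-homo 0ₜ       ρ = 0-homo
  ⟦⟧-homo 1ₜ       ρ = 1-homo

  HoldsEq-homo : ∀ {n} {ρ : Fin n → Fin (size A)} e → HoldsEq A ρ e → HoldsEq B (h ∘ ρ) e
  HoldsEq-homo {ρ = ρ} (s , t) s≡t =
    trans (sym (⟦⟧-homo s ρ)) (trans (cong h s≡t) (⟦⟧-homo t ρ))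

separating-homomorphisms⇒InQ :
  ∀ {I : Set} (A B : FinAlg) (h : I → Fin (size A) → Fin (size B)) →
  (∀ c → IsHomomorphism (asRaw A) (asRaw B) (h c)) →
  (∀ x y → (∀ c → h c x ≡ h c y) → x ≡ y) → InQ B A
separating-homomorphisms⇒InQ A B h h-hom separating q B⊨q ρ hyps =
  separating _ _ λ c → begin
    h c (⟦ A ⟧ₜ s ρ)      ≡⟨ ⟦⟧-homo (h-hom c) s ρ ⟩
    ⟦ B ⟧ₜ s (h c ∘ ρ)    ≡⟨ B⊨q (h c ∘ ρ) (All.map (λ {e} → HoldsEq-homo (h-hom c) e) hyps) ⟩
    ⟦ B ⟧ₜ t (h c ∘ ρ)    ≡⟨ ⟦⟧-homo (h-hom c) t ρ ⟨
    h c (⟦ A ⟧ₜ t ρ)      ∎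
  where
  open ≡-Reasoning
  s = proj₁ (QuasiIdentity.concl q)
  t = proj₂ (QuasiIdentity.concl q)

aboveE : Bool → Fin (size B̄₁)
aboveE false = suc zero
aboveE true  = suc (suc zero)

aboveE-∧ : ∀ p q → meet B̄₁ (aboveE p) (aboveE q) ≡ aboveE (p ∧ q)
aboveE-∧ false false = refl
aboveE-∧ false true  = refl
aboveE-∧ true  false = refl
aboveE-∧ true  true  = refl

aboveE-∨ : ∀ p q → join B̄₁ (aboveE p) (aboveE q) ≡ aboveE (p ∨ q)
aboveE-∨ false false = refl
aboveE-∨ false true  = refl
aboveE-∨ true  false = refl
aboveE-∨ true  true  = refl

aboveE-injective : ∀ {p q} → aboveE p ≡ aboveE q → p ≡ q
aboveE-injective {false} {false} _ = refl
aboveE-injective {true}  {true}  _ = refl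

module AdjoinBottom {X : Set} (_⊓_ _⊔_ : X → X → X) (⊤ : X) where

  _⊓⁺_ : Maybe X → Maybe X → Maybe X
  just x ⊓⁺ just y = just (x ⊓ y)
  _      ⊓⁺ _      = nothing

  _⊔⁺_ : Maybe X → Maybe X → Maybe X
  nothing ⊔⁺ v       = v
  just x  ⊔⁺ nothing = just x
  just x  ⊔⁺ just y  = just (x ⊔ y)

  _*⁺ : Maybe X → Maybe X
  nothing *⁺ = just ⊤
  just _  *⁺ = nothing

  1⊕ : RawPAlgebra
  1⊕ = record
    { Carrier = Maybe X ; _⊓_ = _⊓⁺_ ; _⊔_ = _⊔⁺_ ; _* = _*⁺ ; 0# = nothing ; 1# = just ⊤ }

  toB̄₁ : (X → Bool) → Maybe X → Fin (size B̄₁)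
  toB̄₁ φ nothing  = zero
  toB̄₁ φ (just x) = aboveE (φ x)

  toB̄₁-isHomomorphism : (φ : X → Bool) →
    (∀ x y → φ (x ⊓ y) ≡ φ x ∧ φ y) → (∀ x y → φ (x ⊔ y) ≡ φ x ∨ φ y) → φ ⊤ ≡ true →
    IsHomomorphism 1⊕ (asRaw B̄₁) (toB̄₁ φ)
  toB̄₁-isHomomorphism φ φ-⊓ φ-⊔ φ-⊤ = record
    { ⊓-homo = ⊓-homo ; ⊔-homo = ⊔-homo ; *-homo = *-homo ; 0-homo = refl
    ; 1-homo = cong aboveE φ-⊤ }
    where
    ⊓-homo : ∀ u v → toB̄₁ φ (u ⊓⁺ v) ≡ meet B̄₁ (toB̄₁ φ u) (toB̄₁ φ v)
    ⊓-homo nothing  v        = refl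
    ⊓-homo (just x) nothing  with φ x
    ... | false = refl
    ... | true  = refl
    ⊓-homo (just x) (just y) = trans (cong aboveE (φ-⊓ x y)) (sym (aboveE-∧ (φ x) (φ y)))

    ⊔-homo : ∀ u v → toB̄₁ φ (u ⊔⁺ v) ≡ join B̄₁ (toB̄₁ φ u) (toB̄₁ φ v)
    ⊔-homo nothing  v        = refl
    ⊔-homo (just x) nothing  with φ x
    ... | false = refl
    ... | true  = refl
    ⊔-homo (just x) (just y) = trans (cong aboveE (φ-⊔ x y)) (sym (aboveE-∨ (φ x) (φ y)))

    *-homo : ∀ u → toB̄₁ φ (u *⁺) ≡ star B̄₁ (toB̄₁ φ u)
    *-homo nothing  = cong aboveE φ-⊤
    *-homo (just x) with φ x
    ... | false = refl
    ... | true  = refl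

lookup-injective : ∀ {A : Set} {xs : List A} → Unique xs →
                   ∀ i j → lookup xs i ≡ lookup xs j → i ≡ j
lookup-injective (x∉xs ∷ xs!) zero    zero    _  = refl
lookup-injective (x∉xs ∷ xs!) zero    (suc j) eq = contradiction eq (All.lookup x∉xs (∈-lookup j))
lookup-injective (x∉xs ∷ xs!) (suc i) zero    eq = contradiction (sym eq) (All.lookup x∉xs (∈-lookup i))
lookup-injective (x∉xs ∷ xs!) (suc i) (suc j) eq = cong suc (lookup-injective xs! i j eq)

vectors : ∀ {A : Set} → List A → (n : ℕ) → List (Vec A n)
vectors xs zero    = [] ∷ []
vectors xs (suc n) = cartesianProductWith _∷_ xs (vectors xs n)

∈-vectors : ∀ {A : Set} {xs : List A} → (∀ x → x ∈ xs) → ∀ {n} (v : Vec A n) → v ∈ vectors xs n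
∈-vectors ∈xs []      = here refl
∈-vectors ∈xs (x ∷ v) = ∈-cartesianProductWith⁺ _∷_ (∈xs x) (∈-vectors ∈xs v)

bools : List Bool
bools = true ∷ false ∷ []

∈-bools : ∀ b → b ∈ bools
∈-bools true  = here refl
∈-bools false = there (here refl)

lookup²∘tabulate² : ∀ {A : Set} {m n} (f : Fin m → Fin n → A) a b →
                    Vec.lookup (Vec.lookup (Vec.tabulate (Vec.tabulate ∘ f)) a) b ≡ f a b
lookup²∘tabulate² f a b =
  trans (cong (λ row → Vec.lookup row b) (lookup∘tabulate _ a)) (lookup∘tabulate (f a) b)

module _ (U : RawPAlgebra) where
  open RawPAlgebra U

  record IsSubuniverse (xs : List Carrier) : Set where
    field
      ⊓-closed : ∀ {u v} → u ∈ xs → v ∈ xs → u ⊓ v ∈ xs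
      ⊔-closed : ∀ {u v} → u ∈ xs → v ∈ xs → u ⊔ v ∈ xs
      *-closed : ∀ {u} → u ∈ xs → u * ∈ xs
      0∈       : 0# ∈ xs
      1∈       : 1# ∈ xs

module FiniteSubalgebra (U : RawPAlgebra) (_≟_ : DecidableEquality (RawPAlgebra.Carrier U))
                        {xs : List (RawPAlgebra.Carrier U)} (closed : IsSubuniverse U xs) where
  open RawPAlgebra U
  open IsSubuniverse closed

  private
    distinct : List Carrier
    distinct = deduplicate _≟_ xs

    position : ∀ {u} → u ∈ xs → Fin (length distinct)
    position u∈xs = index (∈-deduplicate⁺ _≟_ {xs = xs} u∈xs)

    lookup∈xs : ∀ i → lookup distinct i ∈ xs
    lookup∈xs i = ∈-deduplicate⁻ _≟_ xs (∈-lookup i)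

  -- abstract: type checking must never unfold the (exponentially long) enumeration
  abstract
    algebra : FinAlg
    algebra = record
      { size = length distinct
      ; meet = λ i j → position (⊓-closed (lookup∈xs i) (lookup∈xs j))
      ; join = λ i j → position (⊔-closed (lookup∈xs i) (lookup∈xs j))
      ; star = λ i → position (*-closed (lookup∈xs i))
      ; bot  = position 0∈
      ; top  = position 1∈
      }

    el : Fin (size algebra) → Carrier
    el = lookup distinct

    el-∈ : ∀ i → el i ∈ xs
    el-∈ = lookup∈xs

    indexOf : ∀ {u} → u ∈ xs → Fin (size algebra)
    indexOf = position

    el-indexOf : ∀ {u} (u∈xs : u ∈ xs) → el (indexOf u∈xs) ≡ u
    el-indexOf u∈xs = sym (lookup-index (∈-deduplicate⁺ _≟_ {xs = xs} u∈xs))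

    el-injective : ∀ i j → el i ≡ el j → i ≡ j
    el-injective = lookup-injective (deduplicate-! _≟_ xs)

    el-isHomomorphism : IsHomomorphism (asRaw algebra) U el
    el-isHomomorphism = record
      { ⊓-homo = λ i j → el-indexOf (⊓-closed (el-∈ i) (el-∈ j))
      ; ⊔-homo = λ i j → el-indexOf (⊔-closed (el-∈ i) (el-∈ j))
      ; *-homo = λ i → el-indexOf (*-closed (el-∈ i))
      ; 0-homo = el-indexOf 0∈
      ; 1-homo = el-indexOf 1∈
      }

wk : ∀ {n} → Term n → Term (suc n)
wk (var i)  = var (suc i)
wk (s ∧ₜ t) = wk s ∧ₜ wk t
wk (s ∨ₜ t) = wk s ∨ₜ wk t
wk (t *ₜ)   = wk t *ₜ
wk 0ₜ       = 0ₜ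
wk 1ₜ       = 1ₜ

infix 4 _≤f_
_≤f_ : ∀ {n} → Term n → Term n → Formula n
s ≤f t = (s ∧ₜ t) ≐ s

∀≤f : ∀ {n} → Term n → Formula (suc n) → Formula n
∀≤f t φ = ∀f ((var zero ≤f wk t) ⇒f φ)

isBotOrAtomF : ∀ {n} → Term n → Formula n
isBotOrAtomF t = ∀≤f t ((var zero ≐ 0ₜ) ∨f (var zero ≐ wk t))

hasHeightTwoF : Formula 1
hasHeightTwoF = (¬f (x ≐ 0ₜ)) ∧f ((¬f isBotOrAtomF x) ∧f
                ∀≤f x ((var zero ≐ wk x) ∨f isBotOrAtomF (var zero)))
  where
  x : Term 1
  x = var zero

isUniqueLowerCoverF : ∀ {n} → Term n → Term n → Formula n
isUniqueLowerCoverF m z = (m ≤f z) ∧f ((¬f (z ≐ m)) ∧f ∀≤f z ((var zero ≐ wk z) ∨f (var zero ≤f wk m)))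

eqvF : Formula 2
eqvF = var zero ≐ var (suc zero)

edgeF : Formula 2
edgeF = (¬f eqvF) ∧f ∃f (isUniqueLowerCoverF (var (suc zero) ∨ₜ var (suc (suc zero))) (var zero))

-- The predicates are phrased so that Sat A hasHeightTwoF x and Sat A edgeF (x ++ y) reduce
-- to HasHeightTwo (x zero) and IsEdge (x zero) (y zero).
module Definable (A : FinAlg) where

  infix 4 _≤_
  _≤_ : Fin (size A) → Fin (size A) → Set
  x ≤ y = meet A x y ≡ x

  IsBotOrAtom : Fin (size A) → Set
  IsBotOrAtom x = ∀ z → z ≤ x → z ≡ bot A ⊎ z ≡ x

  HasHeightTwo : Fin (size A) → Set
  HasHeightTwo x = ¬ x ≡ bot A × ¬ IsBotOrAtom x × (∀ y → y ≤ x → y ≡ x ⊎ IsBotOrAtom y)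

  IsUniqueLowerCover : Fin (size A) → Fin (size A) → Set
  IsUniqueLowerCover m z = m ≤ z × ¬ z ≡ m × (∀ w → w ≤ z → w ≡ z ⊎ w ≤ m)

  IsEdge : Fin (size A) → Fin (size A) → Set
  IsEdge x y = ¬ x ≡ y × Σ (Fin (size A)) (IsUniqueLowerCover (join A x y))

  module _ (G : Graph) where
    open Graph G

    definesGraph : (⌜_⌝ : Fin V → Fin (size A)) → (∀ {u v} → ⌜ u ⌝ ≡ ⌜ v ⌝ → u ≡ v) →
      (∀ v → HasHeightTwo ⌜ v ⌝) → (∀ {x} → HasHeightTwo x → Σ (Fin V) λ v → x ≡ ⌜ v ⌝) →
      (∀ {u v} → adj u v ≡ true → IsEdge ⌜ u ⌝ ⌜ v ⌝) →
      (∀ {u v} → IsEdge ⌜ u ⌝ ⌜ v ⌝ → adj u v ≡ true) →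
      Defines A 1 hasHeightTwoF eqvF edgeF G
    definesGraph ⌜_⌝ ⌜⌝-injective ⌜⌝-hasHeightTwo hasHeightTwo⇒⌜⌝ adj⇒isEdge isEdge⇒adj =
      vertexOf , surjective , kernel , edges
      where
      vertexOf : (x : Vector (Fin (size A)) 1) → HasHeightTwo (x zero) → Fin V
      vertexOf x h = proj₁ (hasHeightTwo⇒⌜⌝ h)

      ⌜vertexOf⌝ : ∀ x h → x zero ≡ ⌜ vertexOf x h ⌝
      ⌜vertexOf⌝ x h = proj₂ (hasHeightTwo⇒⌜⌝ h)

      surjective : ∀ v → Σ (Vector (Fin (size A)) 1) λ x → Σ (HasHeightTwo (x zero)) λ h → vertexOf x h ≡ v
      surjective v =
        (λ _ → ⌜ v ⌝) , ⌜⌝-hasHeightTwo v , sym (⌜⌝-injective (⌜vertexOf⌝ (λ _ → ⌜ v ⌝) (⌜⌝-hasHeightTwo v)))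

      kernel : ∀ x y p q → (vertexOf x p ≡ vertexOf y q → x zero ≡ y zero)
                         × (x zero ≡ y zero → vertexOf x p ≡ vertexOf y q)
      kernel x y p q =
          (λ eq → trans (⌜vertexOf⌝ x p) (trans (cong ⌜_⌝ eq) (sym (⌜vertexOf⌝ y q))))
        , (λ eq → ⌜⌝-injective (trans (sym (⌜vertexOf⌝ x p)) (trans eq (⌜vertexOf⌝ y q))))

      edges : ∀ x y p q → (adj (vertexOf x p) (vertexOf y q) ≡ true → IsEdge (x zero) (y zero))
                        × (IsEdge (x zero) (y zero) → adj (vertexOf x p) (vertexOf y q) ≡ true)
      edges x y p q =
          (λ uv → subst₂ IsEdge (sym (⌜vertexOf⌝ x p)) (sym (⌜vertexOf⌝ y q)) (adj⇒isEdge uv))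
        , (λ e → isEdge⇒adj (subst₂ IsEdge (⌜vertexOf⌝ x p) (⌜vertexOf⌝ y q) e))

module Subgraphs (G : Graph) where
  open Graph G

  adj-irreflexive : ∀ {v} → ¬ T (adj v v)
  adj-irreflexive {v} = subst T (irrefl v)

  adj-symmetric : ∀ {a b} → T (adj a b) → T (adj b a)
  adj-symmetric {a} {b} = subst T (adj-sym a b)

  adj-within : ∀ {u v a b} → T (adj a b) → a ≡ u ⊎ a ≡ v → b ≡ u ⊎ b ≡ v → T (adj u v)
  adj-within ab (inj₁ refl) (inj₁ refl) = contradiction ab adj-irreflexive
  adj-within ab (inj₁ refl) (inj₂ refl) = ab
  adj-within ab (inj₂ refl) (inj₁ refl) = adj-symmetric ab
  adj-within ab (inj₂ refl) (inj₂ refl) = contradiction ab adj-irreflexive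

  record Subgraph : Set where
    field
      vertex    : Fin V → Bool
      arc       : Fin V → Fin V → Bool
      arc-valid : ∀ {a b} → T (arc a b) → T (adj a b) × T (vertex a) × T (vertex b)

  open Subgraph public

  infix 4 _⊆_ _≈_
  record _⊆_ (H K : Subgraph) : Set where
    constructor mk⊆
    field
      vertex-⊆ : ∀ {a} → T (vertex H a) → T (vertex K a)
      arc-⊆    : ∀ {a b} → T (arc H a b) → T (arc K a b)

  record _≈_ (H K : Subgraph) : Set where
    constructor mk≈
    field
      vertex-≡ : ∀ a → vertex H a ≡ vertex K a
      arc-≡    : ∀ a b → arc H a b ≡ arc K a b

  open _⊆_ public
  open _≈_ public

  ⊆-antisym : ∀ {H K} → H ⊆ K → K ⊆ H → H ≈ K
  ⊆-antisym H⊆K K⊆H =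
    mk≈ (λ a → T-ext (vertex-⊆ H⊆K) (vertex-⊆ K⊆H)) (λ a b → T-ext (arc-⊆ H⊆K) (arc-⊆ K⊆H))

  ≈⇒⊆ : ∀ {H K} → H ≈ K → H ⊆ K
  ≈⇒⊆ H≈K = mk⊆ (λ {a} → subst T (vertex-≡ H≈K a)) (λ {a} {b} → subst T (arc-≡ H≈K a b))

  infixl 7 _∩_
  infixl 6 _∪_
  _∩_ : Subgraph → Subgraph → Subgraph
  H ∩ K = record
    { vertex    = λ a → vertex H a ∧ vertex K a
    ; arc       = λ a b → arc H a b ∧ arc K a b
    ; arc-valid = λ p → let (pH , pK) = to T-∧ p
                            (ab , aH , bH) = arc-valid H pH
                            (_  , aK , bK) = arc-valid K pK
                        in ab , from T-∧ (aH , aK) , from T-∧ (bH , bK)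
    }

  _∪_ : Subgraph → Subgraph → Subgraph
  H ∪ K = record
    { vertex    = λ a → vertex H a ∨ vertex K a
    ; arc       = λ a b → arc H a b ∨ arc K a b
    ; arc-valid = λ p → [ (λ pH → let (ab , aH , bH) = arc-valid H pH
                                  in ab , from T-∨ (inj₁ aH) , from T-∨ (inj₁ bH))
                        , (λ pK → let (ab , aK , bK) = arc-valid K pK
                                  in ab , from T-∨ (inj₂ aK) , from T-∨ (inj₂ bK))
                        ] (to T-∨ p)
    }

  whole : Subgraph
  whole = record { vertex = λ _ → true ; arc = adj ; arc-valid = λ ab → ab , tt , tt }

  ∅ : Subgraph
  ∅ = record { vertex = λ _ → false ; arc = λ _ _ → false ; arc-valid = λ () }

  ⟨_⟩ : Fin V → Subgraph
  ⟨ v ⟩ = record { vertex = λ a → ⌊ a ≟ v ⌋ ; arc = λ _ _ → false ; arc-valid = λ () }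

  ⟨_⟶_⟩ : Fin V → Fin V → Subgraph
  ⟨ u ⟶ v ⟩ = record
    { vertex    = vertex (⟨ u ⟩ ∪ ⟨ v ⟩)
    ; arc       = λ a b → (⌊ a ≟ u ⌋ ∧ ⌊ b ≟ v ⌋) ∧ adj a b
    ; arc-valid = λ {a} {b} p →
        let (au-bv , ab) = to (T-∧ {⌊ a ≟ u ⌋ ∧ ⌊ b ≟ v ⌋}) p
            (au , bv)    = to (T-∧ {⌊ a ≟ u ⌋}) au-bv
        in ab , from T-∨ (inj₁ au) , from (T-∨ {⌊ b ≟ u ⌋}) (inj₂ bv)
    }

  ⊆⇒∩≈ : ∀ {H K} → H ⊆ K → H ∩ K ≈ H
  ⊆⇒∩≈ H⊆K = mk≈ (λ a → ∧-implied (vertex-⊆ H⊆K)) (λ a b → ∧-implied (arc-⊆ H⊆K))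

  ∩≈⇒⊆ : ∀ {H K} → H ∩ K ≈ H → H ⊆ K
  ∩≈⇒⊆ {H} {K} H∩K≈H = mk⊆
    (λ {a} p → proj₂ (to (T-∧ {vertex H a}) (subst T (sym (vertex-≡ H∩K≈H a)) p)))
    (λ {a} {b} p → proj₂ (to (T-∧ {arc H a b}) (subst T (sym (arc-≡ H∩K≈H a b)) p)))

  vertexless-⊆ : ∀ {H K} → (∀ a → ¬ T (vertex H a)) → H ⊆ K
  vertexless-⊆ {H} no-vertex = mk⊆
    (λ {a} p → contradiction p (no-vertex a))
    (λ {a} p → contradiction (proj₁ (proj₂ (arc-valid H p))) (no-vertex a))

  ⟨⟩-⊆ : ∀ {v H} → T (vertex H v) → ⟨ v ⟩ ⊆ H
  ⟨⟩-⊆ {H = H} p = mk⊆ (λ q → subst (T ∘ vertex H) (sym (toWitness q)) p) λ ()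

  ⊆⟨⟩-vertexless : ∀ {K v} → K ⊆ ⟨ v ⟩ → ¬ T (vertex K v) → ∀ a → ¬ T (vertex K a)
  ⊆⟨⟩-vertexless {K} K⊆⟨v⟩ v∉K a a∈K = v∉K (subst (T ∘ vertex K) (toWitness (vertex-⊆ K⊆⟨v⟩ a∈K)) a∈K)

  arc-nonadjacent : ∀ H {a b} → ¬ T (adj a b) → arc H a b ≡ false
  arc-nonadjacent H ¬ab = T-ext (λ p → ¬ab (proj₁ (arc-valid H p))) λ ()

  ∈⟨⟩∪⟨⟩ : ∀ {u v a} → T (vertex (⟨ u ⟩ ∪ ⟨ v ⟩) a) → a ≡ u ⊎ a ≡ v
  ∈⟨⟩∪⟨⟩ {u} {v} {a} p = Sum.map toWitness toWitness (to (T-∨ {⌊ a ≟ u ⌋} {⌊ a ≟ v ⌋}) p)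

  v∈⟨v⟩ : ∀ v → T (vertex ⟨ v ⟩ v)
  v∈⟨v⟩ v = fromWitness refl

  u∈⟨u⟩∪⟨v⟩ : ∀ u v → T (vertex (⟨ u ⟩ ∪ ⟨ v ⟩) u)
  u∈⟨u⟩∪⟨v⟩ u v = from (T-∨ {⌊ u ≟ u ⌋} {⌊ u ≟ v ⌋}) (inj₁ (fromWitness refl))

  arc-⟨⟶⟩ : ∀ {u v a b} → T (arc ⟨ u ⟶ v ⟩ a b) → a ≡ u × b ≡ v
  arc-⟨⟶⟩ {u} {v} {a} {b} p =
    Product.map toWitness toWitness (to (T-∧ {⌊ a ≟ u ⌋}) (proj₁ (to (T-∧ {⌊ a ≟ u ⌋ ∧ ⌊ b ≟ v ⌋}) p)))

  ⟨⟶⟩-⊆ : ∀ {u v K} → T (arc K u v) → ⟨ u ⟶ v ⟩ ⊆ K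
  ⟨⟶⟩-⊆ {u} {v} {K} uv∈K = mk⊆ vertices arcs
    where
    vertices : ∀ {a} → T (vertex ⟨ u ⟶ v ⟩ a) → T (vertex K a)
    vertices {a} p with ∈⟨⟩∪⟨⟩ {u} {v} {a} p | arc-valid K uv∈K
    ... | inj₁ refl | _ , u∈K , _   = u∈K
    ... | inj₂ refl | _ , _   , v∈K = v∈K

    arcs : ∀ {a b} → T (arc ⟨ u ⟶ v ⟩ a b) → T (arc K a b)
    arcs {a} {b} p with arc-⟨⟶⟩ {u} {v} {a} {b} p
    ... | refl , refl = uv∈K

module SubgraphAlgebra (G : Graph) where
  open Graph G
  open Subgraphs G

  -- Subgraphs are stored as Boolean tables to get decidable equality and an enumeration.
  Table : Set
  Table = Vec Bool V × Vec (Vec Bool V) V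

  tabulateTable : (Fin V → Bool) → (Fin V → Fin V → Bool) → Table
  tabulateTable s t = Vec.tabulate s , Vec.tabulate (Vec.tabulate ∘ t)

  vertexᵗ : Table → Fin V → Bool
  vertexᵗ (s , _) = Vec.lookup s

  arcᵗ : Table → Fin V → Fin V → Bool
  arcᵗ (_ , t) a = Vec.lookup (Vec.lookup t a)

  tabulateTable-cong : ∀ {s s′ t t′} → (∀ a → s a ≡ s′ a) → (∀ a b → t a b ≡ t′ a b) →
                       tabulateTable s t ≡ tabulateTable s′ t′
  tabulateTable-cong s≗s′ t≗t′ =
    cong₂ _,_ (tabulate-cong s≗s′) (tabulate-cong (λ a → tabulate-cong (t≗t′ a)))

  _⊓ᵗ_ _⊔ᵗ_ : Table → Table → Table
  r ⊓ᵗ r′ = tabulateTable (λ a → vertexᵗ r a ∧ vertexᵗ r′ a) (λ a b → arcᵗ r a b ∧ arcᵗ r′ a b)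
  r ⊔ᵗ r′ = tabulateTable (λ a → vertexᵗ r a ∨ vertexᵗ r′ a) (λ a b → arcᵗ r a b ∨ arcᵗ r′ a b)

  encode : Subgraph → Table
  encode H = tabulateTable (vertex H) (arc H)

  encode-cong : ∀ {H K} → H ≈ K → encode H ≡ encode K
  encode-cong H≈K = tabulateTable-cong (vertex-≡ H≈K) (arc-≡ H≈K)

  encode-injective : ∀ {H K} → encode H ≡ encode K → H ≈ K
  encode-injective {H} {K} eq = mk≈
      (λ a → trans (sym (lookup∘tabulate (vertex H) a))
                   (trans (cong (λ r → vertexᵗ r a) eq) (lookup∘tabulate (vertex K) a)))
      (λ a b → trans (sym (lookup²∘tabulate² (arc H) a b))
                     (trans (cong (λ r → arcᵗ r a b) eq) (lookup²∘tabulate² (arc K) a b)))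

  encode-∩ : ∀ H K → encode H ⊓ᵗ encode K ≡ encode (H ∩ K)
  encode-∩ H K = tabulateTable-cong
    (λ a → cong₂ _∧_ (lookup∘tabulate (vertex H) a) (lookup∘tabulate (vertex K) a))
    (λ a b → cong₂ _∧_ (lookup²∘tabulate² (arc H) a b) (lookup²∘tabulate² (arc K) a b))

  encode-∪ : ∀ H K → encode H ⊔ᵗ encode K ≡ encode (H ∪ K)
  encode-∪ H K = tabulateTable-cong
    (λ a → cong₂ _∨_ (lookup∘tabulate (vertex H) a) (lookup∘tabulate (vertex K) a))
    (λ a b → cong₂ _∨_ (lookup²∘tabulate² (arc H) a b) (lookup²∘tabulate² (arc K) a b))

  restrict : Table → Subgraph
  restrict r = record
    { vertex    = vertexᵗ r
    ; arc       = λ a b → arcᵗ r a b ∧ (adj a b ∧ (vertexᵗ r a ∧ vertexᵗ r b))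
    ; arc-valid = λ {a} {b} p →
        let (ab , endpoints) = to (T-∧ {adj a b}) (proj₂ (to (T-∧ {arcᵗ r a b}) p))
        in ab , to (T-∧ {vertexᵗ r a}) endpoints
    }

  restrict-encode : ∀ H → restrict (encode H) ≈ H
  restrict-encode H = mk≈ (lookup∘tabulate (vertex H)) λ a b →
    trans (cong₂ _∧_ (lookup²∘tabulate² (arc H) a b)
                     (cong (adj a b ∧_) (cong₂ _∧_ (lookup∘tabulate (vertex H) a)
                                                   (lookup∘tabulate (vertex H) b))))
          (∧-implied λ p → let (ab , aH , bH) = arc-valid H p in from T-∧ (ab , from T-∧ (aH , bH)))

  tables : List Table
  tables = cartesianProduct (vectors bools V) (vectors (vectors bools V) V)

  ∈-tables : ∀ r → r ∈ tables
  ∈-tables (s , t) = ∈-cartesianProduct⁺ (∈-vectors ∈-bools s) (∈-vectors (∈-vectors ∈-bools) t)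

  elements : List (Maybe Table)
  elements = nothing ∷ map (just ∘ encode ∘ restrict) tables

  nothing∈ : nothing ∈ elements
  nothing∈ = here refl

  encode∈ : ∀ H → just (encode H) ∈ elements
  encode∈ H = there (subst (_∈ map (just ∘ encode ∘ restrict) tables)
                           (cong just (encode-cong (restrict-encode H)))
                           (∈-map⁺ (just ∘ encode ∘ restrict) (∈-tables (encode H))))

  ∈-elements : ∀ {u} → u ∈ elements → u ≡ nothing ⊎ Σ Subgraph λ H → u ≡ just (encode H)
  ∈-elements (here u≡nothing) = inj₁ u≡nothing
  ∈-elements (there p) = let (r , _ , eq) = ∈-map⁻ (just ∘ encode ∘ restrict) p in inj₂ (restrict r , eq)

  open AdjoinBottom _⊓ᵗ_ _⊔ᵗ_ (encode whole)

  elements-isSubuniverse : IsSubuniverse 1⊕ elements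
  elements-isSubuniverse = record
    { ⊓-closed = ⊓-closed ; ⊔-closed = ⊔-closed ; *-closed = *-closed
    ; 0∈ = nothing∈ ; 1∈ = encode∈ whole }
    where
    ⊓-closed : ∀ {u v} → u ∈ elements → v ∈ elements → u ⊓⁺ v ∈ elements
    ⊓-closed p q with ∈-elements p | ∈-elements q
    ... | inj₁ refl       | _               = nothing∈
    ... | inj₂ (H , refl) | inj₁ refl       = nothing∈
    ... | inj₂ (H , refl) | inj₂ (K , refl) =
      subst (_∈ elements) (cong just (sym (encode-∩ H K))) (encode∈ (H ∩ K))

    ⊔-closed : ∀ {u v} → u ∈ elements → v ∈ elements → u ⊔⁺ v ∈ elements
    ⊔-closed p q with ∈-elements p | ∈-elements q
    ... | inj₁ refl       | _               = q
    ... | inj₂ (H , refl) | inj₁ refl       = p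
    ... | inj₂ (H , refl) | inj₂ (K , refl) =
      subst (_∈ elements) (cong just (sym (encode-∪ H K))) (encode∈ (H ∪ K))

    *-closed : ∀ {u} → u ∈ elements → u *⁺ ∈ elements
    *-closed p with ∈-elements p
    ... | inj₁ refl       = encode∈ whole
    ... | inj₂ (H , refl) = nothing∈

  _≟ᵗ_ : DecidableEquality (Maybe Table)
  _≟ᵗ_ = Maybeₚ.≡-dec (Productₚ.≡-dec (Vecₚ.≡-dec _≟ᵇ_) (Vecₚ.≡-dec (Vecₚ.≡-dec _≟ᵇ_)))

  open FiniteSubalgebra 1⊕ _≟ᵗ_ elements-isSubuniverse public

  -- support separates the new bottom from the empty subgraph when G has no vertices
  data Coordinate : Set where
    support  : Coordinate
    vertexAt : Fin V → Coordinate
    arcAt    : ∀ a b → T (adj a b) → Coordinate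

  coordinate : Coordinate → Table → Bool
  coordinate support       _ = true
  coordinate (vertexAt a)  r = vertexᵗ r a
  coordinate (arcAt a b _) r = arcᵗ r a b

  coordinate-⊓ : ∀ c r r′ → coordinate c (r ⊓ᵗ r′) ≡ coordinate c r ∧ coordinate c r′
  coordinate-⊓ support       r r′ = refl
  coordinate-⊓ (vertexAt a)  r r′ = lookup∘tabulate _ a
  coordinate-⊓ (arcAt a b _) r r′ = lookup²∘tabulate² _ a b

  coordinate-⊔ : ∀ c r r′ → coordinate c (r ⊔ᵗ r′) ≡ coordinate c r ∨ coordinate c r′
  coordinate-⊔ support       r r′ = refl
  coordinate-⊔ (vertexAt a)  r r′ = lookup∘tabulate _ a
  coordinate-⊔ (arcAt a b _) r r′ = lookup²∘tabulate² _ a b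

  coordinate-whole : ∀ c → coordinate c (encode whole) ≡ true
  coordinate-whole support        = refl
  coordinate-whole (vertexAt a)   = lookup∘tabulate _ a
  coordinate-whole (arcAt a b ab) = trans (lookup²∘tabulate² adj a b) (to T-≡ ab)

  coordinates-separate : ∀ {u v} → u ∈ elements → v ∈ elements →
                         (∀ c → toB̄₁ (coordinate c) u ≡ toB̄₁ (coordinate c) v) → u ≡ v
  coordinates-separate p q eq with ∈-elements p | ∈-elements q
  ... | inj₁ refl       | inj₁ refl       = refl
  ... | inj₁ refl       | inj₂ (K , refl) = contradiction (eq support) λ ()
  ... | inj₂ (H , refl) | inj₁ refl       = contradiction (eq support) λ ()
  ... | inj₂ (H , refl) | inj₂ (K , refl) = cong just (encode-cong {H} {K} (mk≈ same-vertices same-arcs))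
    where
    same-vertices : ∀ a → vertex H a ≡ vertex K a
    same-vertices a = trans (sym (lookup∘tabulate (vertex H) a))
                            (trans (aboveE-injective (eq (vertexAt a))) (lookup∘tabulate (vertex K) a))

    same-arcs : ∀ a b → arc H a b ≡ arc K a b
    same-arcs a b with T? (adj a b)
    ... | yes ab = trans (sym (lookup²∘tabulate² (arc H) a b))
                         (trans (aboveE-injective (eq (arcAt a b ab))) (lookup²∘tabulate² (arc K) a b))
    ... | no ¬ab = trans (arc-nonadjacent H ¬ab) (sym (arc-nonadjacent K ¬ab))

  algebra∈Q : InQ B̄₁ algebra
  algebra∈Q = separating-homomorphisms⇒InQ algebra B̄₁ project project-isHomomorphism
    λ i j eq → el-injective i j (coordinates-separate (el-∈ i) (el-∈ j) eq)
    where
    project : Coordinate → Fin (size algebra) → Fin (size B̄₁)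
    project c = toB̄₁ (coordinate c) ∘ el

    project-isHomomorphism : ∀ c → IsHomomorphism (asRaw algebra) (asRaw B̄₁) (project c)
    project-isHomomorphism c = ∘-isHomomorphism
      (toB̄₁-isHomomorphism (coordinate c) (coordinate-⊓ c) (coordinate-⊔ c) (coordinate-whole c))
      el-isHomomorphism

  open Definable algebra
  open IsHomomorphism el-isHomomorphism using (⊓-homo; ⊔-homo; 0-homo)

  ⌜_⌝ : Subgraph → Fin (size algebra)
  ⌜ H ⌝ = indexOf (encode∈ H)

  el-⌜⌝ : ∀ H → el ⌜ H ⌝ ≡ just (encode H)
  el-⌜⌝ H = el-indexOf (encode∈ H)

  view : ∀ x → x ≡ bot algebra ⊎ Σ Subgraph λ H → x ≡ ⌜ H ⌝
  view x with ∈-elements (el-∈ x)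
  ... | inj₁ eq       = inj₁ (el-injective _ _ (trans eq (sym 0-homo)))
  ... | inj₂ (H , eq) = inj₂ (H , el-injective _ _ (trans eq (sym (el-⌜⌝ H))))

  ⌜⌝-cong : ∀ {H K} → H ≈ K → ⌜ H ⌝ ≡ ⌜ K ⌝
  ⌜⌝-cong {H} {K} H≈K = el-injective _ _ (begin
    el ⌜ H ⌝          ≡⟨ el-⌜⌝ H ⟩
    just (encode H)  ≡⟨ cong just (encode-cong H≈K) ⟩
    just (encode K)  ≡⟨ el-⌜⌝ K ⟨
    el ⌜ K ⌝          ∎)
    where open ≡-Reasoning

  ⌜⌝-injective : ∀ {H K} → ⌜ H ⌝ ≡ ⌜ K ⌝ → H ≈ K
  ⌜⌝-injective {H} {K} eq =
    encode-injective (Maybeₚ.just-injective (trans (sym (el-⌜⌝ H)) (trans (cong el eq) (el-⌜⌝ K))))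

  ⌜⌝-⊓ : ∀ H K → meet algebra ⌜ H ⌝ ⌜ K ⌝ ≡ ⌜ H ∩ K ⌝
  ⌜⌝-⊓ H K = el-injective _ _ (begin
    el (meet algebra ⌜ H ⌝ ⌜ K ⌝)  ≡⟨ ⊓-homo ⌜ H ⌝ ⌜ K ⌝ ⟩
    el ⌜ H ⌝ ⊓⁺ el ⌜ K ⌝          ≡⟨ cong₂ _⊓⁺_ (el-⌜⌝ H) (el-⌜⌝ K) ⟩
    just (encode H ⊓ᵗ encode K)   ≡⟨ cong just (encode-∩ H K) ⟩
    just (encode (H ∩ K))         ≡⟨ el-⌜⌝ (H ∩ K) ⟨
    el ⌜ H ∩ K ⌝                   ∎)
    where open ≡-Reasoning

  ⌜⌝-⊔ : ∀ H K → join algebra ⌜ H ⌝ ⌜ K ⌝ ≡ ⌜ H ∪ K ⌝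
  ⌜⌝-⊔ H K = el-injective _ _ (begin
    el (join algebra ⌜ H ⌝ ⌜ K ⌝)  ≡⟨ ⊔-homo ⌜ H ⌝ ⌜ K ⌝ ⟩
    el ⌜ H ⌝ ⊔⁺ el ⌜ K ⌝          ≡⟨ cong₂ _⊔⁺_ (el-⌜⌝ H) (el-⌜⌝ K) ⟩
    just (encode H ⊔ᵗ encode K)   ≡⟨ cong just (encode-∪ H K) ⟩
    just (encode (H ∪ K))         ≡⟨ el-⌜⌝ (H ∪ K) ⟨
    el ⌜ H ∪ K ⌝                   ∎)
    where open ≡-Reasoning

  ⌜⌝-mono : ∀ {H K} → H ⊆ K → ⌜ H ⌝ ≤ ⌜ K ⌝
  ⌜⌝-mono {H} {K} H⊆K = trans (⌜⌝-⊓ H K) (⌜⌝-cong (⊆⇒∩≈ H⊆K))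

  ⌜⌝-reflects-≤ : ∀ {H K} → ⌜ H ⌝ ≤ ⌜ K ⌝ → H ⊆ K
  ⌜⌝-reflects-≤ {H} {K} H≤K = ∩≈⇒⊆ (⌜⌝-injective (trans (sym (⌜⌝-⊓ H K)) H≤K))

  ⌜⌝-reflects-≡ : ∀ {H K} → ⌜ H ⌝ ≡ ⌜ K ⌝ → H ⊆ K
  ⌜⌝-reflects-≡ = ≈⇒⊆ ∘ ⌜⌝-injective

  ⌜⌝≢bot : ∀ H → ¬ ⌜ H ⌝ ≡ bot algebra
  ⌜⌝≢bot H eq = contradiction (trans (sym (el-⌜⌝ H)) (trans (cong el eq) 0-homo)) λ ()

  ⌜⌝≰bot : ∀ H → ¬ ⌜ H ⌝ ≤ bot algebra
  ⌜⌝≰bot H H≤bot = contradiction (begin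
    just (encode H)                        ≡⟨ el-⌜⌝ H ⟨
    el ⌜ H ⌝                                ≡⟨ cong el H≤bot ⟨
    el (meet algebra ⌜ H ⌝ (bot algebra))  ≡⟨ ⊓-homo ⌜ H ⌝ (bot algebra) ⟩
    el ⌜ H ⌝ ⊓⁺ el (bot algebra)           ≡⟨ cong₂ _⊓⁺_ (el-⌜⌝ H) 0-homo ⟩
    nothing                                ∎) λ ()
    where open ≡-Reasoning

  bot-≤ : ∀ x → bot algebra ≤ x
  bot-≤ x = el-injective _ _ (trans (⊓-homo (bot algebra) x) (trans (cong (_⊓⁺ el x) 0-homo) (sym 0-homo)))

  bot-isBotOrAtom : IsBotOrAtom (bot algebra)
  bot-isBotOrAtom z z≤bot with view z
  ... | inj₁ z≡bot      = inj₁ z≡bot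
  ... | inj₂ (K , refl) = contradiction z≤bot (⌜⌝≰bot K)

  vertexless-isBotOrAtom : ∀ H → (∀ a → ¬ T (vertex H a)) → IsBotOrAtom ⌜ H ⌝
  vertexless-isBotOrAtom H no-vertex z z≤H with view z
  ... | inj₁ z≡bot      = inj₁ z≡bot
  ... | inj₂ (K , refl) = inj₂ (⌜⌝-cong (⊆-antisym (⌜⌝-reflects-≤ z≤H) (vertexless-⊆ no-vertex)))

  vertex⇒¬isBotOrAtom : ∀ H {a} → T (vertex H a) → ¬ IsBotOrAtom ⌜ H ⌝
  vertex⇒¬isBotOrAtom H a∈H atom with atom ⌜ ∅ ⌝ (⌜⌝-mono (vertexless-⊆ {∅} {H} λ _ ()))
  ... | inj₁ ∅≡bot = ⌜⌝≢bot ∅ ∅≡bot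
  ... | inj₂ ∅≡H   = vertex-⊆ (⌜⌝-reflects-≡ {H} {∅} (sym ∅≡H)) a∈H

  ⟨⟩-injective : ∀ {u v} → ⌜ ⟨ u ⟩ ⌝ ≡ ⌜ ⟨ v ⟩ ⌝ → u ≡ v
  ⟨⟩-injective {u} {v} eq = toWitness (vertex-⊆ (⌜⌝-reflects-≡ {⟨ u ⟩} {⟨ v ⟩} eq) (v∈⟨v⟩ u))

  ⟨⟩-hasHeightTwo : ∀ v → HasHeightTwo ⌜ ⟨ v ⟩ ⌝
  ⟨⟩-hasHeightTwo v = ⌜⌝≢bot ⟨ v ⟩ , vertex⇒¬isBotOrAtom ⟨ v ⟩ (v∈⟨v⟩ v) , below
    where
    below : ∀ y → y ≤ ⌜ ⟨ v ⟩ ⌝ → y ≡ ⌜ ⟨ v ⟩ ⌝ ⊎ IsBotOrAtom y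
    below y y≤v with view y
    ... | inj₁ refl       = inj₂ bot-isBotOrAtom
    ... | inj₂ (K , refl) with T? (vertex K v)
    ...   | yes v∈K = inj₁ (⌜⌝-cong (⊆-antisym (⌜⌝-reflects-≤ y≤v) (⟨⟩-⊆ v∈K)))
    ...   | no  v∉K = inj₂ (vertexless-isBotOrAtom K (⊆⟨⟩-vertexless (⌜⌝-reflects-≤ {K} {⟨ v ⟩} y≤v) v∉K))

  hasHeightTwo⇒⟨⟩ : ∀ {x} → HasHeightTwo x → Σ (Fin V) λ v → x ≡ ⌜ ⟨ v ⟩ ⌝
  hasHeightTwo⇒⟨⟩ {x} (x≢bot , ¬atom , below) with view x
  ... | inj₁ x≡bot      = contradiction x≡bot x≢bot
  ... | inj₂ (H , refl) with any? (λ a → T? (vertex H a))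
  ...   | no no-vertex = contradiction (vertexless-isBotOrAtom H λ a a∈H → no-vertex (a , a∈H)) ¬atom
  ...   | yes (v , v∈H) with below ⌜ ⟨ v ⟩ ⌝ (⌜⌝-mono (⟨⟩-⊆ v∈H))
  ...     | inj₁ ⟨v⟩≡H = v , sym ⟨v⟩≡H
  ...     | inj₂ atom  = contradiction atom (vertex⇒¬isBotOrAtom ⟨ v ⟩ (v∈⟨v⟩ v))

  ⟨⟶⟩-isUniqueLowerCover : ∀ {u v} → T (adj u v) →
                           IsUniqueLowerCover ⌜ ⟨ u ⟩ ∪ ⟨ v ⟩ ⌝ ⌜ ⟨ u ⟶ v ⟩ ⌝
  ⟨⟶⟩-isUniqueLowerCover {u} {v} uv =
      ⌜⌝-mono {⟨ u ⟩ ∪ ⟨ v ⟩} {⟨ u ⟶ v ⟩} (mk⊆ (λ p → p) λ ())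
    , (λ eq → arc-⊆ (⌜⌝-reflects-≡ {⟨ u ⟶ v ⟩} {⟨ u ⟩ ∪ ⟨ v ⟩} eq) uv∈⟨u⟶v⟩)
    , below
    where
    uv∈⟨u⟶v⟩ : T (arc ⟨ u ⟶ v ⟩ u v)
    uv∈⟨u⟶v⟩ = from (T-∧ {⌊ u ≟ u ⌋ ∧ ⌊ v ≟ v ⌋})
                    (from (T-∧ {⌊ u ≟ u ⌋}) (fromWitness refl , fromWitness refl) , uv)

    below : ∀ w → w ≤ ⌜ ⟨ u ⟶ v ⟩ ⌝ → w ≡ ⌜ ⟨ u ⟶ v ⟩ ⌝ ⊎ w ≤ ⌜ ⟨ u ⟩ ∪ ⟨ v ⟩ ⌝
    below w w≤z with view w
    ... | inj₁ refl       = inj₂ (bot-≤ ⌜ ⟨ u ⟩ ∪ ⟨ v ⟩ ⌝)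
    ... | inj₂ (K , refl) with T? (arc K u v)
    ...   | yes uv∈K = inj₁ (⌜⌝-cong {K} {⟨ u ⟶ v ⟩} (⊆-antisym K⊆ (⟨⟶⟩-⊆ uv∈K)))
      where K⊆ = ⌜⌝-reflects-≤ {K} {⟨ u ⟶ v ⟩} w≤z
    ...   | no  uv∉K = inj₂ (⌜⌝-mono {K} {⟨ u ⟩ ∪ ⟨ v ⟩} (mk⊆ (vertex-⊆ K⊆) no-arc))
      where
      K⊆ = ⌜⌝-reflects-≤ {K} {⟨ u ⟶ v ⟩} w≤z
      no-arc : ∀ {a b} → T (arc K a b) → T (arc (⟨ u ⟩ ∪ ⟨ v ⟩) a b)
      no-arc {a} {b} ab∈K with arc-⟨⟶⟩ {u} {v} {a} {b} (arc-⊆ K⊆ ab∈K)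
      ... | refl , refl = uv∉K ab∈K

  isUniqueLowerCover⇒adj : ∀ {u v z} → IsUniqueLowerCover ⌜ ⟨ u ⟩ ∪ ⟨ v ⟩ ⌝ z → T (adj u v)
  isUniqueLowerCover⇒adj {u} {v} {z} (pair≤z , z≢pair , below) with view z
  ... | inj₁ refl       = contradiction pair≤z (⌜⌝≰bot (⟨ u ⟩ ∪ ⟨ v ⟩))
  ... | inj₂ (H , refl) with T? (adj u v)
  ...   | yes uv  = uv
  ...   | no  ¬uv = contradiction (⌜⌝-cong (⊆-antisym (mk⊆ vertices arcs) pair⊆H)) z≢pair
    where
    pair⊆H = ⌜⌝-reflects-≤ {⟨ u ⟩ ∪ ⟨ v ⟩} {H} pair≤z

    vertices : ∀ {a} → T (vertex H a) → T (vertex (⟨ u ⟩ ∪ ⟨ v ⟩) a)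
    vertices {a} a∈H with below ⌜ ⟨ a ⟩ ⌝ (⌜⌝-mono (⟨⟩-⊆ {a} {H} a∈H))
    ... | inj₁ ⟨a⟩≡H   = subst (T ∘ vertex (⟨ u ⟩ ∪ ⟨ v ⟩)) (toWitness u∈⟨a⟩) (u∈⟨u⟩∪⟨v⟩ u v)
      where
      u∈⟨a⟩ : T (vertex ⟨ a ⟩ u)
      u∈⟨a⟩ = vertex-⊆ (⌜⌝-reflects-≡ {H} {⟨ a ⟩} (sym ⟨a⟩≡H)) (vertex-⊆ pair⊆H (u∈⟨u⟩∪⟨v⟩ u v))
    ... | inj₂ ⟨a⟩≤pair = vertex-⊆ (⌜⌝-reflects-≤ {⟨ a ⟩} {⟨ u ⟩ ∪ ⟨ v ⟩} ⟨a⟩≤pair) (v∈⟨v⟩ a)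

    arcs : ∀ {a b} → T (arc H a b) → T (arc (⟨ u ⟩ ∪ ⟨ v ⟩) a b)
    arcs ab∈H = let (ab , a∈H , b∈H) = arc-valid H ab∈H in
      contradiction (adj-within ab (∈⟨⟩∪⟨⟩ (vertices a∈H)) (∈⟨⟩∪⟨⟩ (vertices b∈H))) ¬uv

  adj⇒isEdge : ∀ {u v} → adj u v ≡ true → IsEdge ⌜ ⟨ u ⟩ ⌝ ⌜ ⟨ v ⟩ ⌝
  adj⇒isEdge {u} {v} uv =
      (λ eq → adj-irreflexive (subst (T ∘ adj u) (sym (⟨⟩-injective eq)) (from T-≡ uv)))
    , ⌜ ⟨ u ⟶ v ⟩ ⌝
    , subst (λ m → IsUniqueLowerCover m ⌜ ⟨ u ⟶ v ⟩ ⌝) (sym (⌜⌝-⊔ ⟨ u ⟩ ⟨ v ⟩))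
            (⟨⟶⟩-isUniqueLowerCover (from T-≡ uv))

  isEdge⇒adj : ∀ {u v} → IsEdge ⌜ ⟨ u ⟩ ⌝ ⌜ ⟨ v ⟩ ⌝ → adj u v ≡ true
  isEdge⇒adj {u} {v} (_ , z , cover) =
    to T-≡ (isUniqueLowerCover⇒adj (subst (λ m → IsUniqueLowerCover m z) (⌜⌝-⊔ ⟨ u ⟩ ⟨ v ⟩) cover))

  defines : Defines algebra 1 hasHeightTwoF eqvF edgeF G
  defines = definesGraph G (λ v → ⌜ ⟨ v ⟩ ⌝)
    ⟨⟩-injective ⟨⟩-hasHeightTwo hasHeightTwo⇒⟨⟩ adj⇒isEdge isEdge⇒adj

lemma4 : Σ ℕ λ k → Σ (Formula k) λ dom → Σ (Formula (k + k)) λ eqv → Σ (Formula (k + k)) λ edge →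
           (G : Graph) → Σ FinAlg λ A → InQ B̄₁ A × Defines A k dom eqv edge G
lemma4 = 1 , hasHeightTwoF , eqvF , edgeF , λ G →
  SubgraphAlgebra.algebra G , SubgraphAlgebra.algebra∈Q G , SubgraphAlgebra.defines G
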